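{- Suppose $n>2$ and let $\sigma=(1\,2\,\dots\,n)\in S_n$. The stabilizer in $G$ of $M=I+P_\sigma$ is isomorphic to the dihedral group $D_{4n}$ with $4n$ elements, and the $G$-orbit of $M$ has $(n-1)!\,n!/2$ elements.
   Context: $P_\sigma$ is the permutation matrix of $\sigma\in S_n$ with $P_\sigma P_\tau=P_{\sigma\tau}$, and $I$ is the $n\times n$ identity matrix. $G$ is the group of order $2(n!)^2$ acting on $n\times n$ matrices by the maps $M\mapsto P_\alpha M P_\beta^{ -1}$ and $M\mapsto P_\alpha M^T P_\beta^{ -1}$ for $\alpha,\beta\in S_n$ (generated by row permutations, column permutations and transpose). -}

module Defs where

open import Data.Nat using (ℕ; zero; suc; _+_; _∸_)
open import Data.Nat.DivMod using (_mod_)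
open import Data.Fin using (Fin; toℕ)
open import Data.Fin.Permutation using (Permutation′; _⟨$⟩ʳ_; _⟨$⟩ˡ_; _∘ₚ_)
open import Data.Bool using (Bool; true; false; not; _xor_; if_then_else_)
open import Data.Product using (Σ; ∃; _×_; _,_; proj₁)
open import Relation.Binary.PropositionalEquality using (_≡_)
open import Relation.Nullary using (¬_; does)
open import Data.Fin using (_≟_)

Mat : ℕ → Set
Mat n = Fin n → Fin n → ℕ

_≈M_ : ∀ {n} → Mat n → Mat n → Set
A ≈M B = ∀ i j → A i j ≡ B i j

transposeM : ∀ {n} → Mat n → Mat n
transposeM A i j = A j i

δ : ∀ {n} → Fin n → Fin n → ℕ
δ i j = if does (i ≟ j) then 1 else 0

-- matrix of a function f : Fin n → Fin n, entry (i,j) = [i = f j]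
-- (so that P_σ P_τ = P_{στ})
Pmat : ∀ {n} → (Fin n → Fin n) → Mat n
Pmat f i j = δ i (f j)

idMat : ∀ {n} → Mat n
idMat i j = δ i j

_+M_ : ∀ {n} → Mat n → Mat n → Mat n
(A +M B) i j = A i j + B i j

sucMod : ∀ {n} → Fin n → Fin n
sucMod {suc m} j = (toℕ j + 1) mod (suc m)

-- the n-cycle σ = (1 2 … n), 0-indexed: j ↦ j+1 mod n
cycleσ : ∀ {n} → Fin n → Fin n
cycleσ = sucMod

Mσ : ∀ n → Mat n
Mσ n = idMat +M Pmat (cycleσ {n})

-- The group G of order 2 (n!)²: an element (t , α , β) is the map
--   M ↦ P_α M P_β⁻¹        if t = false
--   M ↦ P_α Mᵀ P_β⁻¹       if t = true

G : ℕ → Set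
G n = Bool × Permutation′ n × Permutation′ n

-- (P_α M P_β⁻¹) i j = M (α⁻¹ i) (β⁻¹ j)
act : ∀ {n} → G n → Mat n → Mat n
act (false , α , β) M i j = M (α ⟨$⟩ˡ i) (β ⟨$⟩ˡ j)
act (true  , α , β) M i j = transposeM M (α ⟨$⟩ˡ i) (β ⟨$⟩ˡ j)

-- product α ∘ γ of permutations (apply γ first)
_·ₚ_ : ∀ {n} → Permutation′ n → Permutation′ n → Permutation′ n
α ·ₚ γ = γ ∘ₚ α

-- group law of G = composition of the maps: act (g ⋆ h) = act g ∘ act h
_⋆_ : ∀ {n} → G n → G n → G n
(false , α , β) ⋆ (s , γ , δ') = (s , α ·ₚ γ , β ·ₚ δ')
(true  , α , β) ⋆ (s , γ , δ') = (not s , α ·ₚ δ' , β ·ₚ γ)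

_≈G_ : ∀ {n} → G n → G n → Set
(t , α , β) ≈G (s , γ , δ') =
  t ≡ s × (∀ i → α ⟨$⟩ʳ i ≡ γ ⟨$⟩ʳ i) × (∀ i → β ⟨$⟩ʳ i ≡ δ' ⟨$⟩ʳ i)

-- Dihedral group with 2m elements (symmetries of a regular m-gon):
-- (e , a) stands for r^a s^e; r^a s^e · r^b s^f = r^(a ± b) s^(e xor f)

addMod : ∀ {m} → Fin m → Fin m → Fin m
addMod {suc m} a b = (toℕ a + toℕ b) mod (suc m)

negMod : ∀ {m} → Fin m → Fin m
negMod {suc m} a = (suc m ∸ toℕ a) mod (suc m)

Dih : ℕ → Set
Dih m = Bool × Fin m

_·D_ : ∀ {m} → Dih m → Dih m → Dih m
(e , a) ·D (f , b) = (e xor f , addMod a (if e then negMod b else b))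

record IsoDih {n : ℕ} (H : G n → Set) (m : ℕ) : Set where
  field
    φ       : Dih m → G n
    φ-in    : ∀ x → H (φ x)
    φ-inj   : ∀ x y → φ x ≈G φ y → x ≡ y
    φ-surj  : ∀ g → H g → ∃ λ x → φ x ≈G g
    φ-hom   : ∀ x y → φ (x ·D y) ≈G (φ x ⋆ φ y)

InOrbit : ∀ {n} → Mat n → Mat n → Set
InOrbit {n} M N = ∃ λ (g : G n) → act g M ≈M N

record HasCard {n : ℕ} (P : Mat n → Set) (k : ℕ) : Set where
  field
    elt   : Fin k → Mat n
    elt-P : ∀ i → P (elt i)
    inj   : ∀ i j → elt i ≈M elt j → i ≡ j
    surj  : ∀ N → P N → ∃ λ i → elt i ≈M N

-- The matrix M = I + P_σ is the biadjacency matrix of a cycle of length 2n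
-- whose vertices alternate between rows and columns: row i is joined to the
-- columns i and i − 1. An element of G permutes rows and columns, possibly
-- exchanging the two, and it fixes M exactly when this permutation is an
-- automorphism of the cycle. An automorphism of a cycle is determined by the
-- images of two adjacent vertices, so these automorphisms form the dihedral
-- group of order 4n.
--
-- For the orbit, composing with stabiliser elements moves every element of G
-- to one that fixes row 0 and maps column 0 to a smaller index than column
-- n − 1 (the two neighbours of row 0). These normal forms are the elements
-- (α , β) of G without transposition such that α 0 = 0 and β 0 < β (n − 1).
-- Distinct normal forms give distinct matrices, since the only non-trivial
-- automorphism fixing row 0 swaps its two neighbours; and there are
-- (n − 1)! · n!/2 of them.

module Submission where

open import Defs
open import Data.Nat using (ℕ; zero; suc; _+_; _*_; _∸_; _/_; _!; _≤_; _<_; s≤s; z≤n; ⌊_/2⌋)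
open import Data.Nat.Properties
  using (+-comm; +-assoc; +-suc; +-identityʳ; ≤-trans; ≤-reflexive; ≤-antisym; <⇒≤; ≮⇒≥; m≤n+m; m∸n+n≡m;
         +-mono-≤; +-monoˡ-≤; *-cancelˡ-<; *-distribˡ-+; n≡⌊n+n/2⌋; +-commutativeSemigroup; module ≤-Reasoning)
open import Data.Nat.DivMod
  using (_%_; _mod_; m%n<n; m%n%n≡m%n; %-distribˡ-+; n%n≡0; m<n⇒m%n≡m; m≡m%n+[m/n]*n; [m+kn]%n≡m%n; m*n/n≡m)
open import Data.Nat.Tactic.RingSolver using (solve-∀)
open import Algebra.Properties.CommutativeSemigroup +-commutativeSemigroup using (interchange)
open import Data.Fin using (Fin; zero; suc; toℕ; fromℕ<; _≟_; opposite; punchIn; combine; remQuot)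
import Data.Fin as Fin
open import Data.Fin.Properties
  using (toℕ-injective; toℕ<n; toℕ-fromℕ<; toℕ-fromℕ; suc-injective; punchIn-injective; injective⇒≤;
         opposite-involutive; combine-remQuot; remQuot-combine)
import Data.Fin.Properties as Finₚ
open import Data.Fin.Permutation
  using (Permutation′; _⟨$⟩ʳ_; _⟨$⟩ˡ_; _≈_; _∘ₚ_; id; permutation; inverseˡ; inverseʳ; reverse;
         insert; remove; insert-punchIn; insert-remove; lift₀; lift₀-cong; lift₀-remove)
open import Data.Bool using (Bool; true; false; not; _xor_; if_then_else_)
open import Data.Bool.Properties using (xor-same; xor-assoc; xor-identityʳ; not-distribˡ-xor)
open import Data.Product using (Σ; ∃; _×_; _,_; proj₁; proj₂; uncurry)
open import Data.Product.Properties using (×-≡,≡→≡)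
open import Data.Sum using (_⊎_; inj₁; inj₂)
open import Data.Empty using (⊥-elim)
open import Function using (_∘_)
open import Function.Bundles using (_↔_; Inverse; mk↔ₛ′)
open import Level using (0ℓ)
open import Relation.Nullary using (¬_; Dec; yes; no; does; contradiction)
open import Relation.Unary using (Pred; Decidable)
open import Relation.Unary.Properties using (∁?)
open import Relation.Binary using (IsEquivalence; Setoid)
import Relation.Binary.Reasoning.Setoid
open import Relation.Binary.PropositionalEquality

δ-≡ : ∀ {n} {x y : Fin n} → x ≡ y → δ x y ≡ 1
δ-≡ {x = x} {y} x≡y with x ≟ y
... | yes _   = refl
... | no x≢y  = ⊥-elim (x≢y x≡y)

δ-≢ : ∀ {n} {x y : Fin n} → ¬ x ≡ y → δ x y ≡ 0
δ-≢ {x = x} {y} x≢y with x ≟ y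
... | yes x≡y = ⊥-elim (x≢y x≡y)
... | no _    = refl

δ-cong-⇔ : ∀ {n k} {x y : Fin n} {u w : Fin k} →
           (x ≡ y → u ≡ w) → (u ≡ w → x ≡ y) → δ x y ≡ δ u w
δ-cong-⇔ {x = x} {y} to from with x ≟ y
... | yes x≡y = sym (δ-≡ (to x≡y))
... | no x≢y  = sym (δ-≢ (λ u≡w → x≢y (from u≡w)))

δ-sym : ∀ {n} (x y : Fin n) → δ x y ≡ δ y x
δ-sym x y = δ-cong-⇔ {x = x} {y} sym sym

δ-injective : ∀ {n k} (h : Fin n → Fin k) → (∀ x y → h x ≡ h y → x ≡ y) →
              ∀ x y → δ (h x) (h y) ≡ δ x y
δ-injective h h-inj x y = δ-cong-⇔ {x = h x} {h y} (h-inj x y) (cong h)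

module Modular (m : ℕ) where

  N : ℕ
  N = suc m

  -- A record rather than an equation of remainders, so that a and b can be
  -- inferred from a proof of a ≡ₘ b.
  infix 4 _≡ₘ_
  record _≡ₘ_ (a b : ℕ) : Set where
    constructor mod-≡
    field remainders-≡ : a % N ≡ b % N

  ≡ₘ-isEquivalence : IsEquivalence _≡ₘ_
  ≡ₘ-isEquivalence = record
    { refl  = mod-≡ refl
    ; sym   = λ (mod-≡ e) → mod-≡ (sym e)
    ; trans = λ (mod-≡ e) (mod-≡ f) → mod-≡ (trans e f)
    }

  ≡ₘ-setoid : Setoid 0ℓ 0ℓ
  ≡ₘ-setoid = record { isEquivalence = ≡ₘ-isEquivalence }

  open IsEquivalence ≡ₘ-isEquivalence public
    renaming (refl to ≡ₘ-refl; sym to ≡ₘ-sym; trans to ≡ₘ-trans)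

  module ≡ₘ-Reasoning = Relation.Binary.Reasoning.Setoid ≡ₘ-setoid

  ≡⇒≡ₘ : ∀ {a b} → a ≡ b → a ≡ₘ b
  ≡⇒≡ₘ refl = ≡ₘ-refl

  %-≡ₘ : ∀ a → a % N ≡ₘ a
  %-≡ₘ a = mod-≡ (m%n%n≡m%n a N)

  N≡ₘ0 : N ≡ₘ 0
  N≡ₘ0 = mod-≡ (n%n≡0 N)

  toℕ-mod : ∀ a → toℕ (a mod N) ≡ a % N
  toℕ-mod a = toℕ-fromℕ< (m%n<n a N)

  toℕ-mod-≡ₘ : ∀ a → toℕ (a mod N) ≡ₘ a
  toℕ-mod-≡ₘ a = ≡ₘ-trans (≡⇒≡ₘ (toℕ-mod a)) (%-≡ₘ a)

  toℕ-injectiveₘ : ∀ {x y : Fin N} → toℕ x ≡ₘ toℕ y → x ≡ y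
  toℕ-injectiveₘ {x} {y} (mod-≡ e) =
    toℕ-injective (trans (sym (m<n⇒m%n≡m (toℕ<n x))) (trans e (m<n⇒m%n≡m (toℕ<n y))))

  mod-toℕ : ∀ (x : Fin N) → toℕ x mod N ≡ x
  mod-toℕ x = toℕ-injectiveₘ (toℕ-mod-≡ₘ (toℕ x))

  mod-injective : ∀ {a b} → a mod N ≡ b mod N → a ≡ₘ b
  mod-injective {a} {b} e =
    ≡ₘ-trans (≡ₘ-sym (toℕ-mod-≡ₘ a)) (≡ₘ-trans (≡⇒≡ₘ (cong toℕ e)) (toℕ-mod-≡ₘ b))

  +-congₘ : ∀ {a b c d} → a ≡ₘ b → c ≡ₘ d → a + c ≡ₘ b + d
  +-congₘ {a} {b} {c} {d} (mod-≡ a≡b) (mod-≡ c≡d) = mod-≡ (begin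
    (a + c) % N          ≡⟨ %-distribˡ-+ a c N ⟩
    (a % N + c % N) % N  ≡⟨ cong₂ (λ u v → (u + v) % N) a≡b c≡d ⟩
    (b % N + d % N) % N  ≡⟨ %-distribˡ-+ b d N ⟨
    (b + d) % N          ∎)
    where open ≡-Reasoning

  +-congˡₘ : ∀ {a b} c → a ≡ₘ b → c + a ≡ₘ c + b
  +-congˡₘ c = +-congₘ ≡ₘ-refl

  +-congʳₘ : ∀ {a b} c → a ≡ₘ b → a + c ≡ₘ b + c
  +-congʳₘ c a≡b = +-congₘ a≡b ≡ₘ-refl

  ∸-inverseₘ : ∀ {y} → y ≤ N → (N ∸ y) + y ≡ₘ 0
  ∸-inverseₘ y≤N = ≡ₘ-trans (≡⇒≡ₘ (m∸n+n≡m y≤N)) N≡ₘ0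

  +-cancelʳₘ : ∀ {a b} c → a + c ≡ₘ b + c → a ≡ₘ b
  +-cancelʳₘ {a} {b} c a+c≡b+c = begin
    a                    ≡⟨ +-identityʳ a ⟨
    a + 0                ≈⟨ +-congˡₘ a c+c′≡0 ⟨
    a + (c + c′)         ≡⟨ +-assoc a c c′ ⟨
    a + c + c′           ≈⟨ +-congʳₘ c′ a+c≡b+c ⟩
    b + c + c′           ≡⟨ +-assoc b c c′ ⟩
    b + (c + c′)         ≈⟨ +-congˡₘ b c+c′≡0 ⟩
    b + 0                ≡⟨ +-identityʳ b ⟩
    b                    ∎
    where
    open ≡ₘ-Reasoning
    c′ : ℕ
    c′ = N ∸ c % N
    c+c′≡0 : c + c′ ≡ₘ 0
    c+c′≡0 = ≡ₘ-trans (≡⇒≡ₘ (+-comm c c′))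
               (≡ₘ-trans (+-congˡₘ c′ (≡ₘ-sym (%-≡ₘ c))) (∸-inverseₘ (<⇒≤ (m%n<n c N))))

  +-cancelˡₘ : ∀ {a b} c → c + a ≡ₘ c + b → a ≡ₘ b
  +-cancelˡₘ {a} {b} c c+a≡c+b =
    +-cancelʳₘ c (≡ₘ-trans (≡⇒≡ₘ (+-comm a c)) (≡ₘ-trans c+a≡c+b (≡⇒≡ₘ (+-comm c b))))

module Cycle (m : ℕ) (2≤m : 2 ≤ m) where

  open Modular m public

  toℕ-sucMod : ∀ a → toℕ (sucMod a) ≡ₘ toℕ a + 1
  toℕ-sucMod a = toℕ-mod-≡ₘ (toℕ a + 1)

  toℕ-addMod : ∀ a b → toℕ (addMod a b) ≡ₘ toℕ a + toℕ b
  toℕ-addMod a b = toℕ-mod-≡ₘ (toℕ a + toℕ b)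

  toℕ-negMod : ∀ a → toℕ (negMod a) + toℕ a ≡ₘ 0
  toℕ-negMod a = ≡ₘ-trans (+-congʳₘ (toℕ a) (toℕ-mod-≡ₘ (N ∸ toℕ a))) (∸-inverseₘ (<⇒≤ (toℕ<n a)))

  sucMod-injective : ∀ x y → sucMod x ≡ sucMod y → x ≡ y
  sucMod-injective x y e = toℕ-injectiveₘ (+-cancelʳₘ 1
    (≡ₘ-trans (≡ₘ-sym (toℕ-sucMod x)) (≡ₘ-trans (≡⇒≡ₘ (cong toℕ e)) (toℕ-sucMod y))))

  sucMod-mod : ∀ j → sucMod (j mod N) ≡ suc j mod N
  sucMod-mod j = toℕ-injectiveₘ (≡ₘ-trans (toℕ-sucMod (j mod N))
    (≡ₘ-trans (+-congʳₘ 1 (toℕ-mod-≡ₘ j)) (≡ₘ-trans (≡⇒≡ₘ (+-comm j 1)) (≡ₘ-sym (toℕ-mod-≡ₘ (suc j))))))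

  2≢ₘ0 : ¬ 2 ≡ₘ 0
  2≢ₘ0 (mod-≡ e) with trans (sym (m<n⇒m%n≡m (s≤s 2≤m))) e
  ... | ()

  mod-≢-suc-suc : ∀ j → ¬ j mod N ≡ suc (suc j) mod N
  mod-≢-suc-suc j e = 2≢ₘ0 (≡ₘ-sym (+-cancelˡₘ j
    (≡ₘ-trans (≡⇒≡ₘ (+-identityʳ j)) (≡ₘ-trans (mod-injective e) (≡⇒≡ₘ (+-comm 2 j))))))

  addMod-assoc : ∀ a b c → addMod (addMod a b) c ≡ addMod a (addMod b c)
  addMod-assoc a b c = toℕ-injectiveₘ (begin
    toℕ (addMod (addMod a b) c)   ≈⟨ toℕ-addMod (addMod a b) c ⟩
    toℕ (addMod a b) + toℕ c      ≈⟨ +-congʳₘ (toℕ c) (toℕ-addMod a b) ⟩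
    toℕ a + toℕ b + toℕ c         ≡⟨ +-assoc (toℕ a) (toℕ b) (toℕ c) ⟩
    toℕ a + (toℕ b + toℕ c)       ≈⟨ +-congˡₘ (toℕ a) (toℕ-addMod b c) ⟨
    toℕ a + toℕ (addMod b c)      ≈⟨ toℕ-addMod a (addMod b c) ⟨
    toℕ (addMod a (addMod b c))   ∎)
    where open ≡ₘ-Reasoning

  addMod-identityˡ : ∀ a → addMod zero a ≡ a
  addMod-identityˡ a = toℕ-injectiveₘ (toℕ-addMod zero a)

  addMod-identityʳ : ∀ a → addMod a zero ≡ a
  addMod-identityʳ a = toℕ-injectiveₘ (≡ₘ-trans (toℕ-addMod a zero) (≡⇒≡ₘ (+-identityʳ (toℕ a))))

  addMod-inverseˡ : ∀ a → addMod (negMod a) a ≡ zero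
  addMod-inverseˡ a = toℕ-injectiveₘ (≡ₘ-trans (toℕ-addMod (negMod a) a) (toℕ-negMod a))

  addMod-inverseʳ : ∀ a → addMod a (negMod a) ≡ zero
  addMod-inverseʳ a = toℕ-injectiveₘ
    (≡ₘ-trans (toℕ-addMod a (negMod a)) (≡ₘ-trans (≡⇒≡ₘ (+-comm (toℕ a) _)) (toℕ-negMod a)))

  negMod-unique : ∀ {x y} → toℕ x + toℕ y ≡ₘ 0 → x ≡ negMod y
  negMod-unique {x} {y} e =
    toℕ-injectiveₘ (+-cancelʳₘ (toℕ y) (≡ₘ-trans e (≡ₘ-sym (toℕ-negMod y))))

  negMod-involutive : ∀ a → negMod (negMod a) ≡ a
  negMod-involutive a = sym (negMod-unique (≡ₘ-trans (≡⇒≡ₘ (+-comm (toℕ a) _)) (toℕ-negMod a)))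

  negMod-addMod : ∀ a b → negMod (addMod a b) ≡ addMod (negMod a) (negMod b)
  negMod-addMod a b = sym (negMod-unique (begin
    toℕ (addMod (negMod a) (negMod b)) + toℕ (addMod a b)
      ≈⟨ +-congₘ (toℕ-addMod (negMod a) (negMod b)) (toℕ-addMod a b) ⟩
    (toℕ (negMod a) + toℕ (negMod b)) + (toℕ a + toℕ b)
      ≡⟨ interchange (toℕ (negMod a)) _ _ _ ⟩
    (toℕ (negMod a) + toℕ a) + (toℕ (negMod b) + toℕ b)
      ≈⟨ +-congₘ (toℕ-negMod a) (toℕ-negMod b) ⟩
    0 ∎))
    where open ≡ₘ-Reasoning

  dih : Dih N → Fin N → Fin N
  dih (e , a) z = addMod a (if e then negMod z else z)

  dih-∙ : ∀ x y z → dih (x ·D y) z ≡ dih x (dih y z)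
  dih-∙ (false , a) (false , b) z = addMod-assoc a b z
  dih-∙ (false , a) (true  , b) z = addMod-assoc a b (negMod z)
  dih-∙ (true  , a) (false , b) z = begin
    addMod (addMod a (negMod b)) (negMod z)  ≡⟨ addMod-assoc a (negMod b) (negMod z) ⟩
    addMod a (addMod (negMod b) (negMod z))  ≡⟨ cong (addMod a) (negMod-addMod b z) ⟨
    addMod a (negMod (addMod b z))           ∎
    where open ≡-Reasoning
  dih-∙ (true  , a) (true  , b) z = begin
    addMod (addMod a (negMod b)) z
      ≡⟨ addMod-assoc a (negMod b) z ⟩
    addMod a (addMod (negMod b) z)
      ≡⟨ cong (λ t → addMod a (addMod (negMod b) t)) (negMod-involutive z) ⟨
    addMod a (addMod (negMod b) (negMod (negMod z)))
      ≡⟨ cong (addMod a) (negMod-addMod b (negMod z)) ⟨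
    addMod a (negMod (addMod b (negMod z)))
      ∎
    where open ≡-Reasoning

  ε-dih : Dih N
  ε-dih = (false , zero)

  dih-ε : ∀ z → dih ε-dih z ≡ z
  dih-ε = addMod-identityˡ

  dih-zero : ∀ x → dih x zero ≡ proj₂ x
  dih-zero (false , a) = addMod-identityʳ a
  dih-zero (true  , a) = trans (cong (addMod a) (sym (negMod-unique {zero} {zero} ≡ₘ-refl))) (addMod-identityʳ a)

  infix 30 _⁻¹D
  _⁻¹D : Dih N → Dih N
  (false , a) ⁻¹D = (false , negMod a)
  (true  , a) ⁻¹D = (true , a)

  ⁻¹D-inverseˡ : ∀ x → x ⁻¹D ·D x ≡ ε-dih
  ⁻¹D-inverseˡ (false , a) = cong (false ,_) (addMod-inverseˡ a)
  ⁻¹D-inverseˡ (true  , a) = cong (false ,_) (addMod-inverseʳ a)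

  ⁻¹D-inverseʳ : ∀ x → x ·D x ⁻¹D ≡ ε-dih
  ⁻¹D-inverseʳ (false , a) = cong (false ,_) (addMod-inverseʳ a)
  ⁻¹D-inverseʳ (true  , a) = cong (false ,_) (addMod-inverseʳ a)

  dih-inverseˡ : ∀ x z → dih (x ⁻¹D) (dih x z) ≡ z
  dih-inverseˡ x z = trans (sym (dih-∙ (x ⁻¹D) x z)) (trans (cong (λ y → dih y z) (⁻¹D-inverseˡ x)) (dih-ε z))

  dih-inverseʳ : ∀ x z → dih x (dih (x ⁻¹D) z) ≡ z
  dih-inverseʳ x z = trans (sym (dih-∙ x (x ⁻¹D) z)) (trans (cong (λ y → dih y z) (⁻¹D-inverseʳ x)) (dih-ε z))

  dih-injective : ∀ x z w → dih x z ≡ dih x w → z ≡ w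
  dih-injective x z w e = trans (sym (dih-inverseˡ x z)) (trans (cong (dih (x ⁻¹D)) e) (dih-inverseˡ x w))

  sucMod-rotation : ∀ a z → sucMod (dih (false , a) z) ≡ dih (false , a) (sucMod z)
  sucMod-rotation a z = toℕ-injectiveₘ (begin
    toℕ (sucMod (addMod a z))   ≈⟨ toℕ-sucMod (addMod a z) ⟩
    toℕ (addMod a z) + 1        ≈⟨ +-congʳₘ 1 (toℕ-addMod a z) ⟩
    toℕ a + toℕ z + 1           ≡⟨ +-assoc (toℕ a) (toℕ z) 1 ⟩
    toℕ a + (toℕ z + 1)         ≈⟨ +-congˡₘ (toℕ a) (toℕ-sucMod z) ⟨
    toℕ a + toℕ (sucMod z)      ≈⟨ toℕ-addMod a (sucMod z) ⟨
    toℕ (addMod a (sucMod z))   ∎)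
    where open ≡ₘ-Reasoning

  toℕ-reflection : ∀ a z → toℕ (dih (true , a) z) + toℕ z ≡ₘ toℕ a
  toℕ-reflection a z = begin
    toℕ (addMod a (negMod z)) + toℕ z  ≈⟨ +-congʳₘ (toℕ z) (toℕ-addMod a (negMod z)) ⟩
    toℕ a + toℕ (negMod z) + toℕ z     ≡⟨ +-assoc (toℕ a) _ _ ⟩
    toℕ a + (toℕ (negMod z) + toℕ z)   ≈⟨ +-congˡₘ (toℕ a) (toℕ-negMod z) ⟩
    toℕ a + 0                          ≡⟨ +-identityʳ (toℕ a) ⟩
    toℕ a                              ∎
    where open ≡ₘ-Reasoning

  reflection-unique : ∀ {a z x} → toℕ x + toℕ z ≡ₘ toℕ a → x ≡ dih (true , a) z
  reflection-unique {a} {z} e = toℕ-injectiveₘ (+-cancelʳₘ (toℕ z) (≡ₘ-trans e (≡ₘ-sym (toℕ-reflection a z))))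

  sucMod-reflection : ∀ a z → sucMod (dih (true , a) (sucMod z)) ≡ dih (true , a) z
  sucMod-reflection a z = reflection-unique (begin
    toℕ (sucMod r) + toℕ z  ≈⟨ +-congʳₘ (toℕ z) (toℕ-sucMod r) ⟩
    toℕ r + 1 + toℕ z       ≡⟨ +-assoc (toℕ r) 1 (toℕ z) ⟩
    toℕ r + (1 + toℕ z)     ≡⟨ cong (toℕ r +_) (+-comm 1 (toℕ z)) ⟩
    toℕ r + (toℕ z + 1)     ≈⟨ +-congˡₘ (toℕ r) (toℕ-sucMod z) ⟨
    toℕ r + toℕ (sucMod z)  ≈⟨ toℕ-reflection a (sucMod z) ⟩
    toℕ a                   ∎)
    where
    open ≡ₘ-Reasoning
    r : Fin N
    r = dih (true , a) (sucMod z)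

  rotation≢reflection : ∀ a → ¬ dih (false , a) (sucMod zero) ≡ dih (true , a) (sucMod zero)
  rotation≢reflection a e = 2≢ₘ0 (≡ₘ-sym (+-cancelˡₘ (toℕ a) (begin
    toℕ a + 0                                 ≡⟨ +-identityʳ (toℕ a) ⟩
    toℕ a                                     ≈⟨ toℕ-reflection a one ⟨
    toℕ (dih (true , a) one) + toℕ one        ≡⟨ cong (λ t → toℕ t + toℕ one) e ⟨
    toℕ (dih (false , a) one) + toℕ one       ≈⟨ +-congₘ (toℕ-addMod a one) (toℕ-sucMod zero) ⟩
    toℕ a + toℕ one + 1                       ≈⟨ +-congʳₘ 1 (+-congˡₘ (toℕ a) (toℕ-sucMod zero)) ⟩
    toℕ a + 1 + 1                             ≡⟨ +-assoc (toℕ a) 1 1 ⟩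
    toℕ a + 2                                 ∎)))
    where
    open ≡ₘ-Reasoning
    one : Fin N
    one = sucMod zero

  dih-faithful : ∀ x y → (∀ z → dih x z ≡ dih y z) → x ≡ y
  dih-faithful (e , a) (e′ , a′) x≗y
    with trans (sym (dih-zero (e , a))) (trans (x≗y zero) (dih-zero (e′ , a′)))
  ... | refl = cong (_, a) (flags e e′ (x≗y (sucMod zero)))
    where
    flags : ∀ e e′ → dih (e , a) (sucMod zero) ≡ dih (e′ , a) (sucMod zero) → e ≡ e′
    flags false false _ = refl
    flags true  true  _ = refl
    flags false true  r = ⊥-elim (rotation≢reflection a r)
    flags true  false r = ⊥-elim (rotation≢reflection a (sym r))

  adj : Fin N → Fin N → ℕ
  adj z w = δ w (sucMod z) + δ z (sucMod w)

  adj-sym : ∀ z w → adj z w ≡ adj w z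
  adj-sym z w = +-comm (δ w (sucMod z)) (δ z (sucMod w))

  adj-sucMod : ∀ z → ¬ adj z (sucMod z) ≡ 0
  adj-sucMod z e rewrite δ-≡ {x = sucMod z} refl with e
  ... | ()

  adj-mod-suc : ∀ j → ¬ adj (j mod N) (suc j mod N) ≡ 0
  adj-mod-suc j = subst (λ t → ¬ adj (j mod N) t ≡ 0) (sucMod-mod j) (adj-sucMod (j mod N))

  adj≢0⇒sucMod : ∀ z w → ¬ adj z w ≡ 0 → w ≡ sucMod z ⊎ z ≡ sucMod w
  adj≢0⇒sucMod z w adj≢0 with w ≟ sucMod z | z ≟ sucMod w
  ... | yes e | _     = inj₁ e
  ... | no _  | yes e = inj₂ e
  ... | no _  | no _  = ⊥-elim (adj≢0 refl)

  third-neighbour : ∀ u w₁ w₂ w₃ → ¬ adj u w₁ ≡ 0 → ¬ adj u w₂ ≡ 0 → ¬ adj u w₃ ≡ 0 →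
                    ¬ w₁ ≡ w₂ → ¬ w₃ ≡ w₁ → w₃ ≡ w₂
  third-neighbour u w₁ w₂ w₃ a₁ a₂ a₃ w₁≢w₂ w₃≢w₁
    with adj≢0⇒sucMod u w₁ a₁ | adj≢0⇒sucMod u w₂ a₂ | adj≢0⇒sucMod u w₃ a₃
  ... | inj₁ e₁ | inj₁ e₂ | _       = ⊥-elim (w₁≢w₂ (trans e₁ (sym e₂)))
  ... | inj₂ e₁ | inj₂ e₂ | _       = ⊥-elim (w₁≢w₂ (sucMod-injective w₁ w₂ (trans (sym e₁) e₂)))
  ... | inj₁ e₁ | inj₂ e₂ | inj₁ e₃ = ⊥-elim (w₃≢w₁ (trans e₃ (sym e₁)))
  ... | inj₁ e₁ | inj₂ e₂ | inj₂ e₃ = sucMod-injective w₃ w₂ (trans (sym e₃) e₂)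
  ... | inj₂ e₁ | inj₁ e₂ | inj₁ e₃ = trans e₃ (sym e₂)
  ... | inj₂ e₁ | inj₁ e₂ | inj₂ e₃ = ⊥-elim (w₃≢w₁ (sucMod-injective w₃ w₁ (trans (sym e₃) e₁)))

  record IsAutomorphism (f : Fin N → Fin N) : Set where
    field
      injective : ∀ z w → f z ≡ f w → z ≡ w
      preserves-adj : ∀ z w → adj (f z) (f w) ≡ adj z w

  dih-isAutomorphism : ∀ x → IsAutomorphism (dih x)
  dih-isAutomorphism x = record { injective = dih-injective x ; preserves-adj = preserves x }
    where
    preserves : ∀ x z w → adj (dih x z) (dih x w) ≡ adj z w
    preserves (false , a) z w = cong₂ _+_ (shift z w) (shift w z)
      where
      t : Fin N → Fin N
      t = dih (false , a)
      shift : ∀ z w → δ (t w) (sucMod (t z)) ≡ δ w (sucMod z)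
      shift z w = trans (cong (δ (t w)) (sucMod-rotation a z))
                        (δ-injective t (dih-injective (false , a)) w (sucMod z))
    preserves (true , a) z w = trans (cong₂ _+_ (flip z w) (flip w z)) (+-comm (δ z (sucMod w)) _)
      where
      r : Fin N → Fin N
      r = dih (true , a)
      flip : ∀ z w → δ (r w) (sucMod (r z)) ≡ δ z (sucMod w)
      flip z w = δ-cong-⇔ {x = r w} {sucMod (r z)} {z} {sucMod w}
        (λ e → sym (dih-injective (true , a) _ _ (sucMod-injective _ _ (trans (sucMod-reflection a w) e))))
        (λ { refl → sym (sucMod-reflection a w) })

  preserves-adj≢0 : ∀ {f} → IsAutomorphism f → ∀ z w → ¬ adj z w ≡ 0 → ¬ adj (f z) (f w) ≡ 0
  preserves-adj≢0 f-aut z w adj≢0 e = adj≢0 (trans (sym (IsAutomorphism.preserves-adj f-aut z w)) e)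

  -- Along the cycle, f (j + 2) is the neighbour of f (j + 1) other than f j.
  automorphisms-agree : ∀ {f g} → IsAutomorphism f → IsAutomorphism g →
                        f zero ≡ g zero → f (sucMod zero) ≡ g (sucMod zero) → ∀ z → f z ≡ g z
  automorphisms-agree {f} {g} f-aut g-aut e₀ e₁ z =
    trans (cong f (sym (mod-toℕ z))) (trans (proj₁ (along (toℕ z))) (cong g (mod-toℕ z)))
    where
    module F = IsAutomorphism f-aut
    step : ∀ j → ¬ adj (suc j mod N) (suc (suc j) mod N) ≡ 0
    step j = adj-mod-suc (suc j)
    back : ∀ j → ¬ adj (suc j mod N) (j mod N) ≡ 0
    back j e = adj-mod-suc j (trans (adj-sym (j mod N) (suc j mod N)) e)
    along : ∀ j → f (j mod N) ≡ g (j mod N) × f (suc j mod N) ≡ g (suc j mod N)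
    along zero = e₀ , e₁
    along (suc j) with along j
    ... | fj≡gj , fj₁≡gj₁ = fj₁≡gj₁ , third-neighbour (g (suc j mod N))
      (g (j mod N)) (g (suc (suc j) mod N)) (f (suc (suc j) mod N))
      (preserves-adj≢0 g-aut _ _ (back j))
      (preserves-adj≢0 g-aut _ _ (step j))
      (subst (λ u → ¬ adj u (f (suc (suc j) mod N)) ≡ 0) fj₁≡gj₁ (preserves-adj≢0 f-aut _ _ (step j)))
      (λ e → mod-≢-suc-suc j (IsAutomorphism.injective g-aut _ _ e))
      (λ e → mod-≢-suc-suc j (sym (F.injective _ _ (trans e (sym fj≡gj)))))

  automorphism⇒dih : ∀ {f} → IsAutomorphism f → Σ (Dih N) λ x → ∀ z → f z ≡ dih x z
  automorphism⇒dih {f} f-aut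
    with adj≢0⇒sucMod (f zero) (f (sucMod zero)) (preserves-adj≢0 f-aut zero (sucMod zero) (adj-sucMod zero))
  ... | inj₁ e = (false , a) , automorphisms-agree f-aut (dih-isAutomorphism (false , a))
          (sym (dih-zero (false , a)))
          (trans e (trans (cong sucMod (sym (dih-zero (false , a)))) (sucMod-rotation a zero)))
    where a = f zero
  ... | inj₂ e = (true , a) , automorphisms-agree f-aut (dih-isAutomorphism (true , a))
          (sym (dih-zero (true , a)))
          (sucMod-injective _ _
            (trans (sym e) (trans (sym (dih-zero (true , a))) (sym (sucMod-reflection a zero)))))
    where a = f zero

-- (false , i) is the row i and (true , j) the column j.
Vertex : ℕ → Set
Vertex n = Bool × Fin n

module _ {n : ℕ} where

  image : G n → Vertex n → Vertex n
  image (false , α , β) (false , i) = (false , α ⟨$⟩ʳ i)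
  image (false , α , β) (true  , j) = (true  , β ⟨$⟩ʳ j)
  image (true  , α , β) (false , i) = (true  , β ⟨$⟩ʳ i)
  image (true  , α , β) (true  , j) = (false , α ⟨$⟩ʳ j)

  preimage : G n → Vertex n → Vertex n
  preimage (false , α , β) (false , i) = (false , α ⟨$⟩ˡ i)
  preimage (false , α , β) (true  , j) = (true  , β ⟨$⟩ˡ j)
  preimage (true  , α , β) (false , i) = (true  , α ⟨$⟩ˡ i)
  preimage (true  , α , β) (true  , j) = (false , β ⟨$⟩ˡ j)

  image-preimage : ∀ g v → image g (preimage g v) ≡ v
  image-preimage (false , α , β) (false , i) = cong (false ,_) (inverseʳ α)
  image-preimage (false , α , β) (true  , j) = cong (true  ,_) (inverseʳ β)
  image-preimage (true  , α , β) (false , i) = cong (false ,_) (inverseʳ α)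
  image-preimage (true  , α , β) (true  , j) = cong (true  ,_) (inverseʳ β)

  preimage-image : ∀ g v → preimage g (image g v) ≡ v
  preimage-image (false , α , β) (false , i) = cong (false ,_) (inverseˡ α)
  preimage-image (false , α , β) (true  , j) = cong (true  ,_) (inverseˡ β)
  preimage-image (true  , α , β) (false , i) = cong (false ,_) (inverseˡ β)
  preimage-image (true  , α , β) (true  , j) = cong (true  ,_) (inverseˡ α)

  image-injective : ∀ g v w → image g v ≡ image g w → v ≡ w
  image-injective g v w e = trans (sym (preimage-image g v)) (trans (cong (preimage g) e) (preimage-image g w))

  image-⋆ : ∀ g h v → image (g ⋆ h) v ≡ image g (image h v)
  image-⋆ (false , _) (false , _) (false , _) = refl
  image-⋆ (false , _) (false , _) (true  , _) = refl
  image-⋆ (false , _) (true  , _) (false , _) = refl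
  image-⋆ (false , _) (true  , _) (true  , _) = refl
  image-⋆ (true  , _) (false , _) (false , _) = refl
  image-⋆ (true  , _) (false , _) (true  , _) = refl
  image-⋆ (true  , _) (true  , _) (false , _) = refl
  image-⋆ (true  , _) (true  , _) (true  , _) = refl

  preimage-⋆ : ∀ g h v → preimage (g ⋆ h) v ≡ preimage h (preimage g v)
  preimage-⋆ g h v = trans (cong (preimage (g ⋆ h)) (sym image-pre)) (preimage-image (g ⋆ h) _)
    where
    image-pre : image (g ⋆ h) (preimage h (preimage g v)) ≡ v
    image-pre = trans (image-⋆ g h _) (trans (cong (image g) (image-preimage h _)) (image-preimage g v))

  image-cong : ∀ g h → g ≈G h → ∀ v → image g v ≡ image h v
  image-cong (false , _) (false , _) (refl , α≈γ , β≈δ) (false , i) = cong (false ,_) (α≈γ i)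
  image-cong (false , _) (false , _) (refl , α≈γ , β≈δ) (true  , j) = cong (true  ,_) (β≈δ j)
  image-cong (true  , _) (true  , _) (refl , α≈γ , β≈δ) (false , i) = cong (true  ,_) (β≈δ i)
  image-cong (true  , _) (true  , _) (refl , α≈γ , β≈δ) (true  , j) = cong (false ,_) (α≈γ j)

  preimage-cong : ∀ g h → g ≈G h → ∀ v → preimage g v ≡ preimage h v
  preimage-cong g h g≈h v = trans (sym (preimage-image h (preimage g v)))
    (cong (preimage h) (trans (sym (image-cong g h g≈h (preimage g v))) (image-preimage g v)))

  side-image : ∀ g v → proj₁ (image g v) ≡ proj₁ v xor proj₁ g
  side-image (false , _) (false , _) = refl
  side-image (false , _) (true  , _) = refl
  side-image (true  , _) (false , _) = refl
  side-image (true  , _) (true  , _) = refl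

  side-preimage : ∀ g v → proj₁ (preimage g v) ≡ proj₁ v xor proj₁ g
  side-preimage (false , _) (false , _) = refl
  side-preimage (false , _) (true  , _) = refl
  side-preimage (true  , _) (false , _) = refl
  side-preimage (true  , _) (true  , _) = refl

image-ext : ∀ {m} (g h : G (suc m)) → (∀ v → image g v ≡ image h v) → g ≈G h
image-ext (false , _) (false , _) e = refl , (λ i → cong proj₂ (e (false , i))) , (λ j → cong proj₂ (e (true , j)))
image-ext (true  , _) (true  , _) e = refl , (λ j → cong proj₂ (e (true , j))) , (λ i → cong proj₂ (e (false , i)))
image-ext (false , _) (true  , _) e with e (false , zero)
... | ()
image-ext (true  , _) (false , _) e with e (false , zero)
... | ()

with-side : ∀ {n b} {v : Vertex n} → proj₁ v ≡ b → (b , proj₂ v) ≡ v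
with-side refl = refl

xor-cancelˡ : ∀ t s → t xor (t xor s) ≡ s
xor-cancelˡ t s = trans (sym (xor-assoc t t s)) (cong (_xor s) (xor-same t))

module _ {n : ℕ} (h : Vertex n ↔ Vertex n) (t : Bool)
         (side-to : ∀ v → proj₁ (Inverse.to h v) ≡ t xor proj₁ v) where

  open Inverse h using (to; from; strictlyInverseˡ; strictlyInverseʳ)

  side-from : ∀ v → proj₁ (from v) ≡ t xor proj₁ v
  side-from v = trans (sym (xor-cancelˡ t _))
    (cong (t xor_) (trans (sym (side-to (from v))) (cong proj₁ (strictlyInverseˡ v))))

  onSide : Bool → Permutation′ n
  onSide b = permutation
    (λ i → proj₂ (to (b , i)))
    (λ i → proj₂ (from (t xor b , i)))
    (λ i → cong proj₂ (trans (cong to (with-side (trans (side-from _) (xor-cancelˡ t b)))) (strictlyInverseˡ _)))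
    (λ i → cong proj₂ (trans (cong from (with-side (side-to _))) (strictlyInverseʳ _)))

  fromSided : G n
  fromSided = (t , onSide t , onSide (not t))

image-fromSided : ∀ {n} (h : Vertex n ↔ Vertex n) t side-to v →
                  image (fromSided h t side-to) v ≡ Inverse.to h v
image-fromSided h false side-to (false , i) = with-side (side-to (false , i))
image-fromSided h false side-to (true  , j) = with-side (side-to (true  , j))
image-fromSided h true  side-to (false , i) = with-side (side-to (false , i))
image-fromSided h true  side-to (true  , j) = with-side (side-to (true  , j))

bit : Bool → ℕ
bit false = 0
bit true  = 1

oddᵇ : ℕ → Bool
oddᵇ zero    = false
oddᵇ (suc u) = not (oddᵇ u)

oddᵇ-+ : ∀ a b → oddᵇ (a + b) ≡ oddᵇ a xor oddᵇ b
oddᵇ-+ zero    b = refl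
oddᵇ-+ (suc a) b = trans (cong not (oddᵇ-+ a b)) (not-distribˡ-xor (oddᵇ a) (oddᵇ b))

oddᵇ-double : ∀ u → oddᵇ (u + u) ≡ false
oddᵇ-double u = trans (oddᵇ-+ u u) (xor-same (oddᵇ u))

oddᵇ-*-even : ∀ q {m} → oddᵇ m ≡ false → oddᵇ (q * m) ≡ false
oddᵇ-*-even zero    _    = refl
oddᵇ-*-even (suc q) {m} e = trans (oddᵇ-+ m (q * m)) (cong₂ _xor_ e (oddᵇ-*-even q e))

oddᵇ-bit-double : ∀ b u → oddᵇ (bit b + (u + u)) ≡ b
oddᵇ-bit-double false u = oddᵇ-double u
oddᵇ-bit-double true  u = cong not (oddᵇ-double u)

⌊bit-double/2⌋ : ∀ b u → ⌊ bit b + (u + u) /2⌋ ≡ u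
⌊bit-double/2⌋ false u       = sym (n≡⌊n+n/2⌋ u)
⌊bit-double/2⌋ true  zero    = refl
⌊bit-double/2⌋ true  (suc u) rewrite +-suc u u = cong suc (⌊bit-double/2⌋ true u)

bit-oddᵇ-⌊/2⌋ : ∀ u → bit (oddᵇ u) + (⌊ u /2⌋ + ⌊ u /2⌋) ≡ u
bit-oddᵇ-⌊/2⌋ zero          = refl
bit-oddᵇ-⌊/2⌋ (suc zero)    = refl
bit-oddᵇ-⌊/2⌋ (suc (suc u)) with oddᵇ u | bit-oddᵇ-⌊/2⌋ u
... | false | e = cong suc (trans (+-suc ⌊ u /2⌋ ⌊ u /2⌋) (cong suc e))
... | true  | e = cong (λ t → suc (suc t)) (trans (+-suc ⌊ u /2⌋ ⌊ u /2⌋) e)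

insert₀-cong : ∀ {m} i {ρ ρ′ : Permutation′ m} → ρ ≈ ρ′ → insert zero i ρ ≈ insert zero i ρ′
insert₀-cong i ρ≈ρ′ zero    = refl
insert₀-cong i {ρ} {ρ′} ρ≈ρ′ (suc x) =
  trans (insert-punchIn zero i ρ x) (trans (cong (punchIn i) (ρ≈ρ′ x)) (sym (insert-punchIn zero i ρ′ x)))

insert₀-injective : ∀ {m} i i′ (ρ ρ′ : Permutation′ m) → insert zero i ρ ≈ insert zero i′ ρ′ → i ≡ i′ × ρ ≈ ρ′
insert₀-injective i i′ ρ ρ′ e with e zero
... | refl = refl , λ x → punchIn-injective i _ _
  (trans (sym (insert-punchIn zero i ρ x)) (trans (e (suc x)) (insert-punchIn zero i ρ′ x)))

permutations : ∀ m → Fin (m !) → Permutation′ m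
permutations zero    _ = id
permutations (suc m) k = uncurry (λ i j → insert zero i (permutations m j)) (remQuot (m !) k)

permutations-combine : ∀ m i j → permutations (suc m) (combine i j) ≡ insert zero i (permutations m j)
permutations-combine m i j = cong (uncurry (λ i j → insert zero i (permutations m j))) (remQuot-combine i j)

permutations-surjective : ∀ m (π : Permutation′ m) → ∃ λ k → permutations m k ≈ π
permutations-surjective zero    π = zero , λ ()
permutations-surjective (suc m) π with permutations-surjective m (remove zero π)
... | j , j≈ = combine (π ⟨$⟩ʳ zero) j , λ x → trans
  (cong (_⟨$⟩ʳ x) (permutations-combine m (π ⟨$⟩ʳ zero) j))
  (trans (insert₀-cong (π ⟨$⟩ʳ zero) j≈ x) (insert-remove zero π x))

permutations-injective : ∀ m k k′ → permutations m k ≈ permutations m k′ → k ≡ k′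
permutations-injective zero    zero zero _ = refl
permutations-injective (suc m) k k′ e = begin
  k                                   ≡⟨ combine-remQuot {suc m} (m !) k ⟨
  uncurry combine (remQuot (m !) k)   ≡⟨ cong (uncurry combine) (split-injective _ _ e) ⟩
  uncurry combine (remQuot (m !) k′)  ≡⟨ combine-remQuot {suc m} (m !) k′ ⟩
  k′                                  ∎
  where
  open ≡-Reasoning
  split-injective : ∀ a b → uncurry (λ i j → insert zero i (permutations m j)) a ≈
                            uncurry (λ i j → insert zero i (permutations m j)) b → a ≡ b
  split-injective (i , j) (i′ , j′) e with insert₀-injective i i′ (permutations m j) (permutations m j′) e
  ... | refl , j≈j′ = cong (i ,_) (permutations-injective m j j′ j≈j′)

count : ∀ {N} {P : Pred (Fin N) 0ℓ} → Decidable P → ℕ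
count {zero}  P? = 0
count {suc N} P? = bit (does (P? zero)) + count (P? ∘ suc)

count-complement : ∀ {N} {P : Pred (Fin N) 0ℓ} (P? : Decidable P) → count P? + count (∁? P?) ≡ N
count-complement {zero}  P? = refl
count-complement {suc N} P? with P? zero | count-complement (P? ∘ suc)
... | yes _ | e = cong suc e
... | no _  | e = trans (+-suc _ _) (cong suc e)

record Enumeration {N} (P : Pred (Fin N) 0ℓ) (c : ℕ) : Set where
  field
    elem            : Fin c → Fin N
    elem-P          : ∀ k → P (elem k)
    elem-injective  : ∀ k k′ → elem k ≡ elem k′ → k ≡ k′
    elem-surjective : ∀ i → P i → ∃ λ k → elem k ≡ i

module _ {N c} {P : Pred (Fin (suc N)) 0ℓ} (E : Enumeration (P ∘ suc) c) where
  open Enumeration E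

  enumeration-skip : ¬ P zero → Enumeration P c
  enumeration-skip ¬P0 = record
    { elem            = suc ∘ elem
    ; elem-P          = elem-P
    ; elem-injective  = λ k k′ e → elem-injective k k′ (suc-injective e)
    ; elem-surjective = surjective
    }
    where
    surjective : ∀ i → P i → ∃ λ k → suc (elem k) ≡ i
    surjective zero    P0 = contradiction P0 ¬P0
    surjective (suc i) Pi = let (k , e) = elem-surjective i Pi in k , cong suc e

  enumeration-cons : P zero → Enumeration P (suc c)
  enumeration-cons P0 = record
    { elem            = elem′
    ; elem-P          = λ { zero → P0 ; (suc k) → elem-P k }
    ; elem-injective  = injective
    ; elem-surjective = surjective
    }
    where
    elem′ : Fin (suc c) → Fin (suc N)
    elem′ zero    = zero
    elem′ (suc k) = suc (elem k)
    injective : ∀ k k′ → elem′ k ≡ elem′ k′ → k ≡ k′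
    injective zero    zero     _ = refl
    injective (suc k) (suc k′) e = cong suc (elem-injective k k′ (suc-injective e))
    surjective : ∀ i → P i → ∃ λ k → elem′ k ≡ i
    surjective zero    _  = zero , refl
    surjective (suc i) Pi = let (k , e) = elem-surjective i Pi in suc k , cong suc e

enumerate : ∀ {N} {P : Pred (Fin N) 0ℓ} (P? : Decidable P) → Enumeration P (count P?)
enumerate {zero}  P? = record { elem = λ () ; elem-P = λ () ; elem-injective = λ () ; elem-surjective = λ () }
enumerate {suc N} P? with P? zero
... | yes P0  = enumeration-cons (enumerate (P? ∘ suc)) P0
... | no ¬P0  = enumeration-skip (enumerate (P? ∘ suc)) ¬P0

count-mono : ∀ {N} {P Q : Pred (Fin N) 0ℓ} (P? : Decidable P) (Q? : Decidable Q) (s : Fin N → Fin N) →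
             (∀ i j → s i ≡ s j → i ≡ j) → (∀ i → P i → Q (s i)) → count P? ≤ count Q?
count-mono P? Q? s s-injective P⇒Q = injective⇒≤ {f = f} f-injective
  where
  module P = Enumeration (enumerate P?)
  module Q = Enumeration (enumerate Q?)
  image-index : ∀ k → ∃ λ k′ → Q.elem k′ ≡ s (P.elem k)
  image-index k = Q.elem-surjective (s (P.elem k)) (P⇒Q (P.elem k) (P.elem-P k))
  f : Fin (count P?) → Fin (count Q?)
  f k = proj₁ (image-index k)
  f-injective : ∀ {k k′} → f k ≡ f k′ → k ≡ k′
  f-injective {k} {k′} e = P.elem-injective k k′ (s-injective _ _
    (trans (sym (proj₂ (image-index k))) (trans (cong Q.elem e) (proj₂ (image-index k′)))))

count-halves : ∀ {N} {P : Pred (Fin N) 0ℓ} (P? : Decidable P) (s : Fin N → Fin N) → (∀ i → s (s i) ≡ i) →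
               (∀ i → P i → ¬ P (s i)) → (∀ i → ¬ P i → P (s i)) → count P? + count P? ≡ N
count-halves P? s s-involutive P⇒¬Ps ¬P⇒Ps = trans (cong (count P? +_) count≡) (count-complement P?)
  where
  s-injective : ∀ i j → s i ≡ s j → i ≡ j
  s-injective i j e = trans (sym (s-involutive i)) (trans (cong s e) (s-involutive j))
  count≡ : count P? ≡ count (∁? P?)
  count≡ = ≤-antisym (count-mono P? (∁? P?) s s-injective P⇒¬Ps) (count-mono (∁? P?) P? s s-injective ¬P⇒Ps)

module IncidenceCycle (p : ℕ) where

  n : ℕ
  n = suc (suc p)

  open Cycle (suc (p + (n + 0))) (s≤s (≤-trans (s≤s z≤n) (m≤n+m (n + 0) p))) public

  bit-double-< : ∀ b (i : Fin n) → bit b + (toℕ i + toℕ i) < N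
  bit-double-< b i = begin-strict
    bit b + (toℕ i + toℕ i)  ≤⟨ +-monoˡ-≤ (toℕ i + toℕ i) (bit≤1 b) ⟩
    1 + (toℕ i + toℕ i)      <⟨ ≤-reflexive (cong suc (sym (+-suc (toℕ i) (toℕ i)))) ⟩
    suc (toℕ i) + suc (toℕ i) ≤⟨ +-mono-≤ (toℕ<n i) (toℕ<n i) ⟩
    n + n                    ≡⟨ cong (n +_) (+-identityʳ n) ⟨
    N                        ∎
    where
    open ≤-Reasoning
    bit≤1 : ∀ b → bit b ≤ 1
    bit≤1 false = z≤n
    bit≤1 true  = s≤s z≤n

  ⌊/2⌋-< : ∀ (z : Fin N) → ⌊ toℕ z /2⌋ < n
  ⌊/2⌋-< z = *-cancelˡ-< 2 h n (begin-strict
    h + (h + 0)                        ≡⟨ cong (h +_) (+-identityʳ h) ⟩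
    h + h                              ≤⟨ m≤n+m (h + h) (bit (oddᵇ (toℕ z))) ⟩
    bit (oddᵇ (toℕ z)) + (h + h)       ≡⟨ bit-oddᵇ-⌊/2⌋ (toℕ z) ⟩
    toℕ z                              <⟨ toℕ<n z ⟩
    N                                  ∎)
    where
    open ≤-Reasoning
    h : ℕ
    h = ⌊ toℕ z /2⌋

  -- Row i is the vertex 2i and column j the vertex 2j + 1 of the cycle.
  toCycle : Vertex n → Fin N
  toCycle (b , i) = (bit b + (toℕ i + toℕ i)) mod N

  fromCycle : Fin N → Vertex n
  fromCycle z = (oddᵇ (toℕ z) , fromℕ< (⌊/2⌋-< z))

  toℕ-toCycle : ∀ b i → toℕ (toCycle (b , i)) ≡ bit b + (toℕ i + toℕ i)
  toℕ-toCycle b i = trans (toℕ-mod (bit b + (toℕ i + toℕ i))) (m<n⇒m%n≡m (bit-double-< b i))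

  fromCycle-toCycle : ∀ v → fromCycle (toCycle v) ≡ v
  fromCycle-toCycle (b , i) = cong₂ _,_
    (trans (cong oddᵇ (toℕ-toCycle b i)) (oddᵇ-bit-double b (toℕ i)))
    (toℕ-injective (trans (toℕ-fromℕ< (⌊/2⌋-< (toCycle (b , i))))
      (trans (cong ⌊_/2⌋ (toℕ-toCycle b i)) (⌊bit-double/2⌋ b (toℕ i)))))

  toCycle-fromCycle : ∀ z → toCycle (fromCycle z) ≡ z
  toCycle-fromCycle z = toℕ-injectiveₘ (≡⇒≡ₘ (begin
    toℕ (toCycle (fromCycle z))      ≡⟨ toℕ-toCycle o h ⟩
    bit o + (toℕ h + toℕ h)          ≡⟨ cong (λ t → bit o + (t + t)) (toℕ-fromℕ< (⌊/2⌋-< z)) ⟩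
    bit o + (⌊ toℕ z /2⌋ + ⌊ toℕ z /2⌋) ≡⟨ bit-oddᵇ-⌊/2⌋ (toℕ z) ⟩
    toℕ z                            ∎))
    where
    open ≡-Reasoning
    o : Bool
    o = oddᵇ (toℕ z)
    h : Fin n
    h = proj₂ (fromCycle z)

  toCycle-injective : ∀ v w → toCycle v ≡ toCycle w → v ≡ w
  toCycle-injective v w e = trans (sym (fromCycle-toCycle v)) (trans (cong fromCycle e) (fromCycle-toCycle w))

  fromCycle-injective : ∀ z w → fromCycle z ≡ fromCycle w → z ≡ w
  fromCycle-injective z w e = trans (sym (toCycle-fromCycle z)) (trans (cong toCycle e) (toCycle-fromCycle w))

  sucMod-row : ∀ i → sucMod (toCycle (false , i)) ≡ toCycle (true , i)
  sucMod-row i = toℕ-injectiveₘ (begin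
    toℕ (sucMod (toCycle (false , i)))  ≈⟨ toℕ-sucMod (toCycle (false , i)) ⟩
    toℕ (toCycle (false , i)) + 1       ≡⟨ cong (_+ 1) (toℕ-toCycle false i) ⟩
    (toℕ i + toℕ i) + 1                 ≡⟨ +-comm (toℕ i + toℕ i) 1 ⟩
    1 + (toℕ i + toℕ i)                 ≡⟨ toℕ-toCycle true i ⟨
    toℕ (toCycle (true , i))            ∎)
    where open ≡ₘ-Reasoning

  double-%-≡ₘ : ∀ u → u % n + u % n ≡ₘ u + u
  double-%-≡ₘ u = mod-≡ (sym (trans (cong (_% N) (sym decompose)) ([m+kn]%n≡m%n (r + r) q N)))
    where
    r q : ℕ
    r = u % n
    q = u / n
    decompose : r + r + q * N ≡ u + u
    decompose = begin
      r + r + q * N              ≡⟨ cong (r + r +_) (*-distribˡ-+ q n (n + 0)) ⟩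
      r + r + (q * n + q * (n + 0)) ≡⟨ cong (λ t → r + r + (q * n + q * t)) (+-identityʳ n) ⟩
      r + r + (q * n + q * n)    ≡⟨ interchange r r (q * n) (q * n) ⟩
      (r + q * n) + (r + q * n)  ≡⟨ cong (λ t → t + t) (m≡m%n+[m/n]*n u n) ⟨
      u + u                      ∎
      where open ≡-Reasoning

  sucMod-column : ∀ j → sucMod (toCycle (true , j)) ≡ toCycle (false , sucMod j)
  sucMod-column j = toℕ-injectiveₘ (begin
    toℕ (sucMod (toCycle (true , j)))      ≈⟨ toℕ-sucMod (toCycle (true , j)) ⟩
    toℕ (toCycle (true , j)) + 1           ≡⟨ cong (_+ 1) (toℕ-toCycle true j) ⟩
    1 + (toℕ j + toℕ j) + 1                ≡⟨ cong suc (+-comm (toℕ j + toℕ j) 1) ⟩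
    suc (suc (toℕ j + toℕ j))              ≡⟨ cong suc (+-suc (toℕ j) (toℕ j)) ⟨
    suc (toℕ j) + suc (toℕ j)              ≡⟨ cong (λ t → t + t) (+-comm 1 (toℕ j)) ⟩
    (toℕ j + 1) + (toℕ j + 1)              ≈⟨ double-%-≡ₘ (toℕ j + 1) ⟨
    (toℕ j + 1) % n + (toℕ j + 1) % n      ≡⟨ cong (λ t → t + t) (toℕ-fromℕ< (m%n<n (toℕ j + 1) n)) ⟨
    toℕ (sucMod j) + toℕ (sucMod j)        ≡⟨ toℕ-toCycle false (sucMod j) ⟨
    toℕ (toCycle (false , sucMod j))       ∎)
    where open ≡ₘ-Reasoning

  vadj : Vertex n → Vertex n → ℕ
  vadj v w = adj (toCycle v) (toCycle w)

  vadj-sym : ∀ v w → vadj v w ≡ vadj w v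
  vadj-sym v w = adj-sym (toCycle v) (toCycle w)

  rows≢columns : ∀ i j → ¬ toCycle (false , i) ≡ toCycle (true , j)
  rows≢columns i j e with toCycle-injective (false , i) (true , j) e
  ... | ()

  toCycle-side-injective : ∀ b → ∀ i j → toCycle (b , i) ≡ toCycle (b , j) → i ≡ j
  toCycle-side-injective b i j e = cong proj₂ (toCycle-injective (b , i) (b , j) e)

  Mσ-vadj : ∀ i j → Mσ n i j ≡ vadj (false , i) (true , j)
  Mσ-vadj i j = sym (begin
    δ (toCycle (true , j)) (sucMod (toCycle (false , i))) + δ (toCycle (false , i)) (sucMod (toCycle (true , j)))
      ≡⟨ cong₂ (λ a b → δ (toCycle (true , j)) a + δ (toCycle (false , i)) b) (sucMod-row i) (sucMod-column j) ⟩
    δ (toCycle (true , j)) (toCycle (true , i)) + δ (toCycle (false , i)) (toCycle (false , sucMod j))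
      ≡⟨ cong₂ _+_ (δ-injective (λ t → toCycle (true , t)) (toCycle-side-injective true) j i)
                   (δ-injective (λ t → toCycle (false , t)) (toCycle-side-injective false) i (sucMod j)) ⟩
    δ j i + δ i (sucMod j)
      ≡⟨ cong (_+ δ i (sucMod j)) (δ-sym j i) ⟩
    δ i j + δ i (sucMod j) ∎)
    where open ≡-Reasoning

  vadj-same-side : ∀ v w → proj₁ v ≡ proj₁ w → vadj v w ≡ 0
  vadj-same-side (false , i) (false , i′) refl = cong₂ _+_
    (trans (cong (δ (toCycle (false , i′))) (sucMod-row i)) (δ-≢ (rows≢columns i′ i)))
    (trans (cong (δ (toCycle (false , i))) (sucMod-row i′)) (δ-≢ (rows≢columns i i′)))
  vadj-same-side (true , i) (true , i′) refl = cong₂ _+_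
    (trans (cong (δ (toCycle (true , i′))) (sucMod-column i)) (δ-≢ (λ e → rows≢columns (sucMod i) i′ (sym e))))
    (trans (cong (δ (toCycle (true , i))) (sucMod-column i′)) (δ-≢ (λ e → rows≢columns (sucMod i′) i (sym e))))

  oddᵇ-N : oddᵇ N ≡ false
  oddᵇ-N = trans (cong (λ t → oddᵇ (n + t)) (+-identityʳ n)) (oddᵇ-double n)

  oddᵇ-% : ∀ u → oddᵇ (u % N) ≡ oddᵇ u
  oddᵇ-% u = sym (begin
    oddᵇ u                              ≡⟨ cong oddᵇ (m≡m%n+[m/n]*n u N) ⟩
    oddᵇ (u % N + u / N * N)            ≡⟨ oddᵇ-+ (u % N) (u / N * N) ⟩
    oddᵇ (u % N) xor oddᵇ (u / N * N)   ≡⟨ cong (oddᵇ (u % N) xor_) (oddᵇ-*-even (u / N) oddᵇ-N) ⟩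
    oddᵇ (u % N) xor false              ≡⟨ xor-identityʳ (oddᵇ (u % N)) ⟩
    oddᵇ (u % N)                        ∎)
    where open ≡-Reasoning

  oddᵇ-toℕ-mod : ∀ u → oddᵇ (toℕ (u mod N)) ≡ oddᵇ u
  oddᵇ-toℕ-mod u = trans (cong oddᵇ (toℕ-mod u)) (oddᵇ-% u)

  oddᵇ-negMod : ∀ z → oddᵇ (toℕ (negMod z)) ≡ oddᵇ (toℕ z)
  oddᵇ-negMod z = begin
    oddᵇ (toℕ (negMod z))                 ≡⟨ oddᵇ-toℕ-mod (N ∸ toℕ z) ⟩
    oddᵇ (N ∸ toℕ z)                      ≡⟨ xor-identityʳ _ ⟨
    oddᵇ (N ∸ toℕ z) xor false            ≡⟨ cong (oddᵇ (N ∸ toℕ z) xor_) (xor-same (oddᵇ (toℕ z))) ⟨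
    oddᵇ (N ∸ toℕ z) xor (o xor o)        ≡⟨ xor-assoc (oddᵇ (N ∸ toℕ z)) o o ⟨
    (oddᵇ (N ∸ toℕ z) xor o) xor o        ≡⟨ cong (_xor o) (oddᵇ-+ (N ∸ toℕ z) (toℕ z)) ⟨
    oddᵇ (N ∸ toℕ z + toℕ z) xor o        ≡⟨ cong (λ t → oddᵇ t xor o) (m∸n+n≡m (<⇒≤ (toℕ<n z))) ⟩
    oddᵇ N xor o                          ≡⟨ cong (_xor o) oddᵇ-N ⟩
    o                                     ∎
    where
    open ≡-Reasoning
    o : Bool
    o = oddᵇ (toℕ z)

  swapsSides : Dih N → Bool
  swapsSides x = oddᵇ (toℕ (proj₂ x))

  side-dih : ∀ x z → oddᵇ (toℕ (dih x z)) ≡ swapsSides x xor oddᵇ (toℕ z)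
  side-dih (false , a) z = trans (oddᵇ-toℕ-mod (toℕ a + toℕ z)) (oddᵇ-+ (toℕ a) (toℕ z))
  side-dih (true  , a) z = trans (oddᵇ-toℕ-mod (toℕ a + toℕ (negMod z)))
    (trans (oddᵇ-+ (toℕ a) (toℕ (negMod z))) (cong (oddᵇ (toℕ a) xor_) (oddᵇ-negMod z)))

module Stabilizer (p : ℕ) where
  open IncidenceCycle p

  dihV : Dih N → Vertex n → Vertex n
  dihV x v = fromCycle (dih x (toCycle v))

  toCycle-dihV : ∀ x v → toCycle (dihV x v) ≡ dih x (toCycle v)
  toCycle-dihV x v = toCycle-fromCycle (dih x (toCycle v))

  onCycle-dihV : ∀ x z → toCycle (dihV x (fromCycle z)) ≡ dih x z
  onCycle-dihV x z = trans (toCycle-dihV x (fromCycle z)) (cong (dih x) (toCycle-fromCycle z))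

  dihV-∙ : ∀ x y v → dihV (x ·D y) v ≡ dihV x (dihV y v)
  dihV-∙ x y v = cong fromCycle (trans (dih-∙ x y (toCycle v)) (cong (dih x) (sym (toCycle-dihV y v))))

  dihV-inverseˡ : ∀ x v → dihV (x ⁻¹D) (dihV x v) ≡ v
  dihV-inverseˡ x v = trans (cong (λ z → fromCycle (dih (x ⁻¹D) z)) (toCycle-dihV x v))
    (trans (cong fromCycle (dih-inverseˡ x (toCycle v))) (fromCycle-toCycle v))

  dihV-inverseʳ : ∀ x v → dihV x (dihV (x ⁻¹D) v) ≡ v
  dihV-inverseʳ x v = trans (cong (λ z → fromCycle (dih x z)) (toCycle-dihV (x ⁻¹D) v))
    (trans (cong fromCycle (dih-inverseʳ x (toCycle v))) (fromCycle-toCycle v))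

  side-dihV : ∀ x v → proj₁ (dihV x v) ≡ swapsSides x xor proj₁ v
  side-dihV x v = trans (side-dih x (toCycle v)) (cong (λ w → swapsSides x xor proj₁ w) (fromCycle-toCycle v))

  vadj-dihV : ∀ x v w → vadj (dihV x v) (dihV x w) ≡ vadj v w
  vadj-dihV x v w = trans (cong₂ adj (toCycle-dihV x v) (toCycle-dihV x w))
    (IsAutomorphism.preserves-adj (dih-isAutomorphism x) (toCycle v) (toCycle w))

  dihV↔ : Dih N → Vertex n ↔ Vertex n
  dihV↔ x = mk↔ₛ′ (dihV x) (dihV (x ⁻¹D)) (dihV-inverseʳ x) (dihV-inverseˡ x)

  toG : Dih N → G n
  toG x = fromSided (dihV↔ x) (swapsSides x) (side-dihV x)

  image-toG : ∀ x v → image (toG x) v ≡ dihV x v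
  image-toG x = image-fromSided (dihV↔ x) (swapsSides x) (side-dihV x)

  preimage-toG : ∀ x v → preimage (toG x) v ≡ dihV (x ⁻¹D) v
  preimage-toG x v = trans (sym (dihV-inverseˡ x (preimage (toG x) v)))
    (cong (dihV (x ⁻¹D)) (trans (sym (image-toG x (preimage (toG x) v))) (image-preimage (toG x) v)))

  act-vadj : ∀ g i j → act g (Mσ n) i j ≡ vadj (preimage g (false , i)) (preimage g (true , j))
  act-vadj (false , α , β) i j = Mσ-vadj (α ⟨$⟩ˡ i) (β ⟨$⟩ˡ j)
  act-vadj (true  , α , β) i j =
    trans (Mσ-vadj (β ⟨$⟩ˡ j) (α ⟨$⟩ˡ i)) (vadj-sym (false , β ⟨$⟩ˡ j) (true , α ⟨$⟩ˡ i))

  same-side-preimage : ∀ g v w → proj₁ v ≡ proj₁ w → vadj (preimage g v) (preimage g w) ≡ 0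
  same-side-preimage g v w e = vadj-same-side (preimage g v) (preimage g w)
    (trans (side-preimage g v) (trans (cong (_xor proj₁ g) e) (sym (side-preimage g w))))

  act-≈M⇒vadj : ∀ g h → act g (Mσ n) ≈M act h (Mσ n) →
                ∀ v w → vadj (preimage g v) (preimage g w) ≡ vadj (preimage h v) (preimage h w)
  act-≈M⇒vadj g h e (false , i) (true  , j) = trans (sym (act-vadj g i j)) (trans (e i j) (act-vadj h i j))
  act-≈M⇒vadj g h e (true  , j) (false , i) = trans (vadj-sym (preimage g (true , j)) (preimage g (false , i)))
    (trans (act-≈M⇒vadj g h e (false , i) (true , j)) (vadj-sym (preimage h (false , i)) (preimage h (true , j))))
  act-≈M⇒vadj g h e (false , i) (false , i′) =
    trans (same-side-preimage g _ _ refl) (sym (same-side-preimage h _ _ refl))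
  act-≈M⇒vadj g h e (true  , j) (true  , j′) =
    trans (same-side-preimage g _ _ refl) (sym (same-side-preimage h _ _ refl))

  PreservesAdjacency : G n → Set
  PreservesAdjacency g = ∀ v w → vadj (preimage g v) (preimage g w) ≡ vadj v w

  stabilizer⇒preserves : ∀ g → act g (Mσ n) ≈M Mσ n → PreservesAdjacency g
  stabilizer⇒preserves g e v w = trans (act-≈M⇒vadj g ε e v w) (cong₂ vadj (preimage-ε v) (preimage-ε w))
    where
    ε : G n
    ε = (false , id , id)
    preimage-ε : ∀ v → preimage ε v ≡ v
    preimage-ε (false , i) = refl
    preimage-ε (true  , j) = refl

  preserves⇒stabilizer : ∀ g → PreservesAdjacency g → act g (Mσ n) ≈M Mσ n
  preserves⇒stabilizer g pres i j =
    trans (act-vadj g i j) (trans (pres (false , i) (true , j)) (sym (Mσ-vadj i j)))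

  toG-preserves : ∀ x → PreservesAdjacency (toG x)
  toG-preserves x v w = trans (cong₂ vadj (preimage-toG x v) (preimage-toG x w)) (vadj-dihV (x ⁻¹D) v w)

  act-⋆-preserves : ∀ g h → PreservesAdjacency h → act (g ⋆ h) (Mσ n) ≈M act g (Mσ n)
  act-⋆-preserves g h pres i j = begin
    act (g ⋆ h) (Mσ n) i j
      ≡⟨ act-vadj (g ⋆ h) i j ⟩
    vadj (preimage (g ⋆ h) (false , i)) (preimage (g ⋆ h) (true , j))
      ≡⟨ cong₂ vadj (preimage-⋆ g h _) (preimage-⋆ g h _) ⟩
    vadj (preimage h (preimage g (false , i))) (preimage h (preimage g (true , j)))
      ≡⟨ pres _ _ ⟩
    vadj (preimage g (false , i)) (preimage g (true , j))
      ≡⟨ act-vadj g i j ⟨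
    act g (Mσ n) i j
      ∎
    where open ≡-Reasoning

  preserves-image : ∀ g → PreservesAdjacency g → ∀ v w → vadj (image g v) (image g w) ≡ vadj v w
  preserves-image g pres v w =
    trans (sym (pres (image g v) (image g w))) (cong₂ vadj (preimage-image g v) (preimage-image g w))

  onCycle : (Vertex n → Vertex n) → Fin N → Fin N
  onCycle h z = toCycle (h (fromCycle z))

  onCycle-isAutomorphism : ∀ h → (∀ v w → h v ≡ h w → v ≡ w) → (∀ v w → vadj (h v) (h w) ≡ vadj v w) →
                           IsAutomorphism (onCycle h)
  onCycle-isAutomorphism h h-injective h-vadj = record
    { injective = λ z w e → fromCycle-injective z w
        (h-injective _ _ (toCycle-injective (h (fromCycle z)) (h (fromCycle w)) e))
    ; preserves-adj = λ z w → trans (h-vadj (fromCycle z) (fromCycle w))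
        (cong₂ adj (toCycle-fromCycle z) (toCycle-fromCycle w))
    }

  onCycle≗dih⇒≗dihV : ∀ {h x} → (∀ z → onCycle h z ≡ dih x z) → ∀ v → h v ≡ dihV x v
  onCycle≗dih⇒≗dihV {h} {x} h≗x v = begin
    h v                                  ≡⟨ fromCycle-toCycle (h v) ⟨
    fromCycle (toCycle (h v))            ≡⟨ cong (λ w → fromCycle (toCycle (h w))) (fromCycle-toCycle v) ⟨
    fromCycle (onCycle h (toCycle v))    ≡⟨ cong fromCycle (h≗x (toCycle v)) ⟩
    dihV x v                             ∎
    where open ≡-Reasoning

  toG-injective : ∀ x y → toG x ≈G toG y → x ≡ y
  toG-injective x y x≈y = dih-faithful x y λ z → begin
    dih x z                                ≡⟨ onCycle-dihV x z ⟨
    toCycle (dihV x (fromCycle z))         ≡⟨ cong toCycle (image-toG x (fromCycle z)) ⟨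
    toCycle (image (toG x) (fromCycle z))  ≡⟨ cong toCycle (image-cong (toG x) (toG y) x≈y (fromCycle z)) ⟩
    toCycle (image (toG y) (fromCycle z))  ≡⟨ cong toCycle (image-toG y (fromCycle z)) ⟩
    toCycle (dihV y (fromCycle z))         ≡⟨ onCycle-dihV y z ⟩
    dih y z                                ∎
    where open ≡-Reasoning

  toG-surjective : ∀ g → act g (Mσ n) ≈M Mσ n → ∃ λ x → toG x ≈G g
  toG-surjective g g∈stab with automorphism⇒dih (onCycle-isAutomorphism (image g) (image-injective g)
                                  (preserves-image g (stabilizer⇒preserves g g∈stab)))
  ... | x , g≗x =
    x , image-ext (toG x) g (λ v → trans (image-toG x v) (sym (onCycle≗dih⇒≗dihV {image g} {x} g≗x v)))

  toG-homomorphism : ∀ x y → toG (x ·D y) ≈G (toG x ⋆ toG y)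
  toG-homomorphism x y = image-ext (toG (x ·D y)) (toG x ⋆ toG y) λ v → begin
    image (toG (x ·D y)) v               ≡⟨ image-toG (x ·D y) v ⟩
    dihV (x ·D y) v                      ≡⟨ dihV-∙ x y v ⟩
    dihV x (dihV y v)                    ≡⟨ cong (dihV x) (image-toG y v) ⟨
    dihV x (image (toG y) v)             ≡⟨ image-toG x (image (toG y) v) ⟨
    image (toG x) (image (toG y) v)      ≡⟨ image-⋆ (toG x) (toG y) v ⟨
    image (toG x ⋆ toG y) v              ∎
    where open ≡-Reasoning

  stabilizer≅dihedral : IsoDih (λ g → act g (Mσ n) ≈M Mσ n) (2 * n)
  stabilizer≅dihedral = record
    { φ      = toG
    ; φ-in   = λ x → preserves⇒stabilizer (toG x) (toG-preserves x)
    ; φ-inj  = toG-injective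
    ; φ-surj = toG-surjective
    ; φ-hom  = toG-homomorphism
    }

module Orbit (p : ℕ) where
  open IncidenceCycle p
  open Stabilizer p

  L : Fin n
  L = opposite zero

  toℕ-L : toℕ L ≡ suc p
  toℕ-L = toℕ-fromℕ (suc p)

  L≢0 : ¬ L ≡ zero
  L≢0 e with trans (sym toℕ-L) (cong toℕ e)
  ... | ()

  Ordered : Permutation′ n → Set
  Ordered β = β ⟨$⟩ʳ zero Fin.< β ⟨$⟩ʳ L

  reversed : Fin (n !) → Fin (n !)
  reversed k = proj₁ (permutations-surjective n (reverse ∘ₚ permutations n k))

  permutations-reversed : ∀ k x → permutations n (reversed k) ⟨$⟩ʳ x ≡ permutations n k ⟨$⟩ʳ opposite x
  permutations-reversed k = proj₂ (permutations-surjective n (reverse ∘ₚ permutations n k))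

  reversed-involutive : ∀ k → reversed (reversed k) ≡ k
  reversed-involutive k = permutations-injective n _ _ λ x →
    trans (permutations-reversed (reversed k) x)
      (trans (permutations-reversed k (opposite x)) (cong (permutations n k ⟨$⟩ʳ_) (opposite-involutive x)))

  reversed-swaps : ∀ k → permutations n (reversed k) ⟨$⟩ʳ zero ≡ permutations n k ⟨$⟩ʳ L
                       × permutations n (reversed k) ⟨$⟩ʳ L ≡ permutations n k ⟨$⟩ʳ zero
  reversed-swaps k = permutations-reversed k zero ,
    trans (permutations-reversed k L) (cong (permutations n k ⟨$⟩ʳ_) (opposite-involutive zero))

  ordered? : ∀ k → Dec (Ordered (permutations n k))
  ordered? k = permutations n k ⟨$⟩ʳ zero Fin.<? permutations n k ⟨$⟩ʳ L

  #ordered : ℕ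
  #ordered = count ordered?

  #ordered-double : #ordered + #ordered ≡ n !
  #ordered-double = count-halves ordered? reversed reversed-involutive
    (λ k o o′ → Finₚ.<-asym o (subst₂ Fin._<_ (proj₁ (reversed-swaps k)) (proj₂ (reversed-swaps k)) o′))
    (λ k ¬o → subst₂ Fin._<_ (sym (proj₁ (reversed-swaps k))) (sym (proj₂ (reversed-swaps k)))
                (Finₚ.≤∧≢⇒< (≮⇒≥ ¬o) (λ e → L≢0 (permutation-injective (permutations n k) L zero e))))
    where
    permutation-injective : ∀ (π : Permutation′ n) x y → π ⟨$⟩ʳ x ≡ π ⟨$⟩ʳ y → x ≡ y
    permutation-injective π x y e = trans (sym (inverseˡ π)) (trans (cong (π ⟨$⟩ˡ_) e) (inverseˡ π))

  module OrderedEnumeration = Enumeration (enumerate ordered?)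

  orderedPermutation : Fin #ordered → Permutation′ n
  orderedPermutation j = permutations n (OrderedEnumeration.elem j)

  orderedPermutation-ordered : ∀ j → Ordered (orderedPermutation j)
  orderedPermutation-ordered j = OrderedEnumeration.elem-P j

  orderedPermutation-injective : ∀ j j′ → orderedPermutation j ≈ orderedPermutation j′ → j ≡ j′
  orderedPermutation-injective j j′ e = OrderedEnumeration.elem-injective j j′ (permutations-injective n _ _ e)

  orderedPermutation-surjective : ∀ β → Ordered β → ∃ λ j → orderedPermutation j ≈ β
  orderedPermutation-surjective β β-ordered =
    let (k , k≈β) = permutations-surjective n β
        (j , elem-j) = OrderedEnumeration.elem-surjective k (subst₂ Fin._<_ (sym (k≈β zero)) (sym (k≈β L)) β-ordered)
    in j , λ x → trans (cong (λ t → permutations n t ⟨$⟩ʳ x) elem-j) (k≈β x)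

  row₀ col₀ colL : Vertex n
  row₀ = (false , zero)
  col₀ = (true , zero)
  colL = (true , L)

  -- The reflection of the cycle fixing row₀ and swapping its neighbours col₀ and colL.
  ρ : Dih N
  ρ = (true , zero)

  ρ-row₀ : dihV ρ row₀ ≡ row₀
  ρ-row₀ = trans (cong fromCycle (dih-zero ρ)) (fromCycle-toCycle row₀)

  ρ-col₀ : dihV ρ col₀ ≡ colL
  ρ-col₀ = trans (cong fromCycle (sym (reflection-unique (≡ₘ-trans (≡⇒≡ₘ sum≡N) N≡ₘ0)))) (fromCycle-toCycle colL)
    where
    sum≡N : toℕ (toCycle colL) + toℕ (toCycle col₀) ≡ N
    sum≡N = begin
      toℕ (toCycle colL) + toℕ (toCycle col₀)  ≡⟨ cong₂ _+_ (toℕ-toCycle true L) (toℕ-toCycle true zero) ⟩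
      1 + (toℕ L + toℕ L) + 1                  ≡⟨ cong (λ t → 1 + (t + t) + 1) toℕ-L ⟩
      1 + (suc p + suc p) + 1                  ≡⟨ arithmetic p ⟩
      N                                        ∎
      where
      open ≡-Reasoning
      arithmetic : ∀ p → 1 + (suc p + suc p) + 1 ≡ suc (suc (p + (suc (suc p) + 0)))
      arithmetic = solve-∀

  ρ-colL : dihV ρ colL ≡ col₀
  ρ-colL = trans (cong (dihV ρ) (sym ρ-col₀)) (dihV-inverseˡ ρ col₀)

  dihV-row₀ : ∀ x → dihV x row₀ ≡ row₀ → proj₂ x ≡ zero
  dihV-row₀ x fixes = trans (sym (dih-zero x)) (trans (sym (toCycle-dihV x row₀)) (cong toCycle fixes))

  dihV-fixing-row₀ : ∀ x → dihV x row₀ ≡ row₀ → x ≡ ε-dih ⊎ x ≡ ρ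
  dihV-fixing-row₀ (false , a) fixes = inj₁ (cong (false ,_) (dihV-row₀ (false , a) fixes))
  dihV-fixing-row₀ (true  , a) fixes = inj₂ (cong (true ,_) (dihV-row₀ (true , a) fixes))

  act-cong : ∀ g h → g ≈G h → act g (Mσ n) ≈M act h (Mσ n)
  act-cong g h g≈h i j = trans (act-vadj g i j) (trans
    (cong₂ vadj (preimage-cong g h g≈h (false , i)) (preimage-cong g h g≈h (true , j))) (sym (act-vadj h i j)))

  representative : Fin ((n ∸ 1) !) × Fin #ordered → G n
  representative (i , j) = (false , lift₀ (permutations (suc p) i) , orderedPermutation j)

  representative-complete : ∀ g → image g row₀ ≡ row₀ → proj₂ (image g col₀) Fin.< proj₂ (image g colL) →
                            ∃ λ a → representative a ≈G g
  representative-complete (true , α , β) () _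
  representative-complete (false , α , β) α0≡0 β-ordered =
    let (i , i≈) = permutations-surjective (suc p) (remove zero α)
        (j , j≈β) = orderedPermutation-surjective β β-ordered
    in (i , j) , refl , (λ x → trans (lift₀-cong _ _ i≈ x) (lift₀-remove α (cong proj₂ α0≡0) x)) , j≈β

  rotation-row₀ : ∀ v → dihV (false , toCycle v) row₀ ≡ v
  rotation-row₀ v = trans (cong fromCycle (dih-zero (false , toCycle v))) (fromCycle-toCycle v)

  ⋆-toG-row₀ : ∀ g x → dihV x row₀ ≡ preimage g row₀ → image (g ⋆ toG x) row₀ ≡ row₀
  ⋆-toG-row₀ g x e = trans (image-⋆ g (toG x) row₀)
    (trans (cong (image g) (trans (image-toG x row₀) e)) (image-preimage g row₀))

  image-⋆ρ : ∀ g v → image (g ⋆ toG ρ) v ≡ image g (dihV ρ v)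
  image-⋆ρ g v = trans (image-⋆ g (toG ρ) v) (cong (image g) (image-toG ρ v))

  columns-distinct : ∀ g → ¬ proj₂ (image g col₀) ≡ proj₂ (image g colL)
  columns-distinct g e = L≢0 (sym (cong proj₂ (image-injective g col₀ colL
    (×-≡,≡→≡ (trans (side-image g col₀) (sym (side-image g colL)) , e)))))

  Normalised : G n → Set
  Normalised g = image g row₀ ≡ row₀ × proj₂ (image g col₀) Fin.< proj₂ (image g colL)

  order-columns : ∀ g → image g row₀ ≡ row₀ → ∃ λ g′ → act g′ (Mσ n) ≈M act g (Mσ n) × Normalised g′
  order-columns g fixed with proj₂ (image g col₀) Fin.<? proj₂ (image g colL)
  ... | yes ordered = g , (λ i j → refl) , fixed , ordered
  ... | no ¬ordered = g ⋆ toG ρ , act-⋆-preserves g (toG ρ) (toG-preserves ρ) ,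
    trans (image-⋆ρ g row₀) (trans (cong (image g) ρ-row₀) fixed) ,
    subst₂ (λ u v → proj₂ u Fin.< proj₂ v)
      (sym (trans (image-⋆ρ g col₀) (cong (image g) ρ-col₀)))
      (sym (trans (image-⋆ρ g colL) (cong (image g) ρ-colL)))
      (Finₚ.≤∧≢⇒< (≮⇒≥ ¬ordered) (λ e → columns-distinct g (sym e)))

  normalise-⋆ : ∀ g h → PreservesAdjacency h → image (g ⋆ h) row₀ ≡ row₀ →
                ∃ λ g′ → act g′ (Mσ n) ≈M act g (Mσ n) × Normalised g′
  normalise-⋆ g h pres fixed =
    let (g′ , g′≈gh , normalised) = order-columns (g ⋆ h) fixed
    in g′ , (λ i j → trans (g′≈gh i j) (act-⋆-preserves g h pres i j)) , normalised

  normalise : ∀ g → ∃ λ g′ → act g′ (Mσ n) ≈M act g (Mσ n) × Normalised g′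
  normalise g = normalise-⋆ g (toG x) (toG-preserves x) (⋆-toG-row₀ g x (rotation-row₀ (preimage g row₀)))
    where
    x : Dih N
    x = (false , toCycle (preimage g row₀))

  act-≈M⇒dihedral : ∀ g h → act g (Mσ n) ≈M act h (Mσ n) → ∃ λ x → ∀ v → preimage h (image g v) ≡ dihV x v
  act-≈M⇒dihedral g h g≈h =
    let (x , t≗x) = automorphism⇒dih (onCycle-isAutomorphism t t-injective t-vadj)
    in x , onCycle≗dih⇒≗dihV {t} {x} t≗x
    where
    t : Vertex n → Vertex n
    t v = preimage h (image g v)
    t-injective : ∀ v w → t v ≡ t w → v ≡ w
    t-injective v w e = image-injective g v w
      (trans (sym (image-preimage h _)) (trans (cong (image h) e) (image-preimage h _)))
    t-vadj : ∀ v w → vadj (t v) (t w) ≡ vadj v w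
    t-vadj v w = trans (sym (act-≈M⇒vadj g h g≈h (image g v) (image g w)))
                       (cong₂ vadj (preimage-image g v) (preimage-image g w))

  dihV-ε : ∀ v → dihV ε-dih v ≡ v
  dihV-ε v = trans (cong fromCycle (dih-ε (toCycle v))) (fromCycle-toCycle v)

  representative-injective : ∀ a b → representative a ≈G representative b → a ≡ b
  representative-injective (i , j) (i′ , j′) (_ , α≈ , β≈) = cong₂ _,_
    (permutations-injective (suc p) i i′ (λ x → suc-injective (α≈ (suc x))))
    (orderedPermutation-injective j j′ β≈)

  -- Apart from the identity, only ρ fixes row₀, and it would reverse the order of
  -- the images of col₀ and colL.
  representatives-distinct : ∀ a b x →
                             (∀ v → preimage (representative b) (image (representative a) v) ≡ dihV x v) →
                             x ≡ ε-dih ⊎ x ≡ ρ → a ≡ b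
  representatives-distinct a b x t≗x (inj₁ refl) = representative-injective a b
    (image-ext (representative a) (representative b) λ v →
      trans (sym (image-preimage (representative b) _))
            (cong (image (representative b)) (trans (t≗x v) (dihV-ε v))))
  representatives-distinct (i , j) (i′ , j′) x t≗x (inj₂ refl) =
    ⊥-elim (Finₚ.<-asym (orderedPermutation-ordered j′)
      (subst₂ Fin._<_ (swap col₀ colL ρ-col₀) (swap colL col₀ ρ-colL) (orderedPermutation-ordered j)))
    where
    a b : G n
    a = representative (i , j)
    b = representative (i′ , j′)
    swap : ∀ v w → dihV ρ v ≡ w → proj₂ (image a v) ≡ proj₂ (image b w)
    swap v w e = cong proj₂ (trans (sym (image-preimage b (image a v))) (cong (image b) (trans (t≗x v) e)))

  representative-unique : ∀ a b → act (representative a) (Mσ n) ≈M act (representative b) (Mσ n) → a ≡ b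
  representative-unique a b e =
    let (x , t≗x) = act-≈M⇒dihedral (representative a) (representative b) e
    in representatives-distinct a b x t≗x (dihV-fixing-row₀ x (sym (t≗x row₀)))

  orbitElement : Fin ((n ∸ 1) ! * #ordered) → Mat n
  orbitElement q = act (representative (remQuot #ordered q)) (Mσ n)

  orbit-surjective : ∀ M → InOrbit (Mσ n) M → ∃ λ q → orbitElement q ≈M M
  orbit-surjective M (g , g≈M) =
    let (g′ , g′≈g , fixed , ordered) = normalise g
        (a , a≈g′) = representative-complete g′ fixed ordered
    in uncurry combine a , λ i j →
         trans (cong (λ b → act (representative b) (Mσ n) i j) (remQuot-combine (proj₁ a) (proj₂ a)))
               (trans (act-cong (representative a) g′ a≈g′ i j) (trans (g′≈g i j) (g≈M i j)))

  orbit-injective : ∀ q q′ → orbitElement q ≈M orbitElement q′ → q ≡ q′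
  orbit-injective q q′ e = trans (sym (combine-remQuot {(n ∸ 1) !} #ordered q))
    (trans (cong (uncurry combine) (representative-unique _ _ e)) (combine-remQuot {(n ∸ 1) !} #ordered q′))

  orbit-hasCard : HasCard (InOrbit (Mσ n)) ((n ∸ 1) ! * #ordered)
  orbit-hasCard = record
    { elt   = orbitElement
    ; elt-P = λ q → representative (remQuot #ordered q) , λ i j → refl
    ; inj   = orbit-injective
    ; surj  = orbit-surjective
    }

  orbit-size : ((n ∸ 1) ! * n !) / 2 ≡ (n ∸ 1) ! * #ordered
  orbit-size = begin
    ((n ∸ 1) ! * n !) / 2                    ≡⟨ cong (λ t → ((n ∸ 1) ! * t) / 2) #ordered-double ⟨
    ((n ∸ 1) ! * (#ordered + #ordered)) / 2  ≡⟨ cong (_/ 2) (double ((n ∸ 1) !) #ordered) ⟩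
    ((n ∸ 1) ! * #ordered * 2) / 2           ≡⟨ m*n/n≡m ((n ∸ 1) ! * #ordered) 2 ⟩
    (n ∸ 1) ! * #ordered                     ∎
    where
    open ≡-Reasoning
    double : ∀ a c → a * (c + c) ≡ a * c * 2
    double = solve-∀

theorem4p5 : (n : ℕ) → 2 < n →
    IsoDih (λ g → act g (Mσ n) ≈M Mσ n) (2 * n)
    × HasCard (InOrbit (Mσ n)) (((n ∸ 1) ! * n !) / 2)
theorem4p5 (suc (suc (suc k))) _ =
  Stabilizer.stabilizer≅dihedral (suc k) ,
  subst (HasCard (InOrbit (Mσ _))) (sym (Orbit.orbit-size (suc k))) (Orbit.orbit-hasCard (suc k))
theorem4p5 1 (s≤s ())
theorem4p5 2 (s≤s (s≤s ()))
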